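{- Let $n=2^s$ with $s\geq1$, and let $f=\gamma_0+\sum_{i=1}^{n-1}a_i\gamma_{2i}$ with $a_i\in\mathbb{F}_2$. Then $f$ is a permutation of $\mathbb{F}_2^n$ if and only if the number of nonzero coefficients among $1,a_1,\dots,a_{n-1}$ (i.e., the number of nonzero terms of $f$ in this expansion) is odd.
   Context: Let $\mathbbm{1}=(1,\dots,1)\in\mathbb{F}_2^n$, let $\odot$ denote component-wise multiplication in $\mathbb{F}_2^n$, and let $S(x_1,\dots,x_n)=(x_2,\dots,x_n,x_1)$. Define $\gamma_0=\mathrm{id}$ and, for $k\geq1$, $\gamma_{2k}(x)=S^{2k}(x)\odot(\mathbbm{1}+S^{2k-1}(x))\odot(\mathbbm{1}+S^{2k-3}(x))\odot\cdots\odot(\mathbbm{1}+S(x))$, as functions $\mathbb{F}_2^n\to\mathbb{F}_2^n$; sums of functions are pointwise. For even $n$ the functions $\gamma_0,\dots,\gamma_{2n-2}$ are linearly independent, so the expansion is unique. -}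

module Defs where

open import Data.Bool using (Bool; true; false; _xor_; _∧_; not)
open import Data.Nat using (ℕ; zero; suc; _+_; _*_; _∸_; NonZero)
open import Data.Nat.DivMod using (_%_; m%n<n)
open import Data.Fin using (Fin; toℕ; fromℕ<)

-- Vectors of F₂ⁿ, with F₂ represented by Bool (xor = +, ∧ = ·).
F2^ : ℕ → Set
F2^ n = Fin n → Bool

module _ (n : ℕ) .{{_ : NonZero n}} where

  _⊕_ : F2^ n → F2^ n → F2^ n
  (x ⊕ y) i = x i xor y i

  _⊙_ : F2^ n → F2^ n → F2^ n
  (x ⊙ y) i = x i ∧ y i

  𝟙 : F2^ n
  𝟙 _ = true

  zeroV : F2^ n
  zeroV _ = false

  -- k-fold cyclic shift S^k, where S(x₁,…,xₙ) = (x₂,…,xₙ,x₁):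
  -- (S^k x)_i = x_{(i+k) mod n}  (0-based indices).
  Sʰ : ℕ → F2^ n → F2^ n
  Sʰ k x i = x (fromℕ< (m%n<n (toℕ i + k) n))

  prodOdd : ℕ → F2^ n → F2^ n
  prodOdd zero    x = 𝟙
  prodOdd (suc k) x = prodOdd k x ⊙ (𝟙 ⊕ Sʰ (2 * k + 1) x)

  -- γ₀ = id,  γ_{2k}(x) = S^{2k}(x) ⊙ (𝟙+S^{2k-1}x) ⊙ ⋯ ⊙ (𝟙+S(x)) for k ≥ 1.
  -- γ k denotes γ_{2k}.
  γ : ℕ → F2^ n → F2^ n
  γ zero    x = x
  γ (suc k) x = Sʰ (2 * suc k) x ⊙ prodOdd (suc k) x

  sumγ : (ℕ → Bool) → ℕ → F2^ n → F2^ n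
  sumγ a zero    x = zeroV
  sumγ a (suc m) x = sumγ a m x ⊕ (if a (suc m) then γ (suc m) x else zeroV)
    where open import Data.Bool using (if_then_else_)

  fExp : (ℕ → Bool) → F2^ n → F2^ n
  fExp a x = γ zero x ⊕ sumγ a (n ∸ 1) x

countNZ : (ℕ → Bool) → ℕ → ℕ
countNZ a zero    = 0
countNZ a (suc m) = (if a (suc m) then 1 else 0) + countNZ a m
  where open import Data.Bool using (if_then_else_)

{-# OPTIONS --safe #-}
module Submission where

-- Extend x ∈ F₂ⁿ to the n-periodic stream X, so that
--   f(x)ᵢ = Xᵢ + Σₖ aₖ X_{i+2k} ∏_{j<k} (1 + X_{i+2j+1}).
-- Call s an anchor of X when X_s = 1 and the next 1 after s lies at odd distance.
-- A stream without anchors vanishes on one parity class (n is even), and on the other class f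
-- acts as the linear map 1 + Σ aₖ Tᵏ. Over F₂, Δ = 1 + T satisfies Δ^(n/2) = 1 + T^(n/2) = 0 on
-- n/2-periodic sequences because n/2 is a power of 2, so this map is injective as soon as
-- Σ aₖ = 0, i.e. as soon as f has an odd number of terms.
-- A stream X with an anchor has exactly the same anchors as f(X), and X is recovered from f(X)
-- by induction on the distance to the next anchor: X vanishes at odd distance before it, and at
-- even distance 2e only the terms k ≤ e of the sum survive. Streams of the two kinds never share
-- an image, and an injective map of the finite set F₂ⁿ is bijective.
-- When Σ aₖ = 1 instead, the alternating vector 1010…10 and 0 have the same image.

open import Defs
open import Algebra.Bundles using (CommutativeRing)
open import Data.Bool using (Bool; true; false; _xor_; _∧_; not; if_then_else_)
open import Data.Bool.Properties as Bool
  using (xor-∧-commutativeRing; ∧-distribˡ-xor; ∧-distribʳ-xor; ∧-identityʳ; ∧-zeroʳ;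
         xor-identityʳ; xor-comm; xor-assoc; xor-same; not-involutive; ¬-not; not-¬)
open import Data.Empty using (⊥-elim)
open import Data.Fin as Fin using (Fin; toℕ; fromℕ<; punchOut)
open import Data.Fin.Base using (funToFin; finToFun; combine)
open import Data.Fin.Properties
  using (any?; 2↔Bool; injective⇒≤; punchOut-injective; finToFun-funToFin; funToFin-finToFin;
         toℕ-fromℕ<; fromℕ<-cong; toℕ-injective; toℕ<n)
open import Data.Nat
open import Data.Nat.DivMod
  using (_%_; _/_; m%n<n; %-distribˡ-+; [m+n]%n≡m%n; m<n⇒m%n≡m; m≡m%n+[m/n]*n)
open import Data.Nat.GeneralisedArithmetic using (iterate)
open import Data.Nat.Induction using (<-wellFounded)
open import Data.Nat.Properties
open import Data.Nat.Tactic.RingSolver using (solve-∀)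
open import Data.Product using (∃; _×_; _,_; proj₁; proj₂)
open import Data.Sum using (_⊎_; inj₁; inj₂)
open import Function using (_∘_; _⇔_; mk⇔)
open import Function.Bundles using (Inverse)
open import Function.Consequences using (strictlySurjective⇒surjective)
open import Function.Definitions
  using (Bijective; Injective; Surjective; Congruent; StrictlySurjective)
open import Function.Properties.Equivalence using () renaming (trans to ⇔-trans; sym to ⇔-sym)
open import Induction.WellFounded using (Acc; acc)
open import Relation.Binary.Definitions using (tri<; tri≈; tri>)
open import Relation.Binary.PropositionalEquality
open import Relation.Nullary using (¬_; Dec; yes; no; contradiction)

open CommutativeRing xor-∧-commutativeRing
  using () renaming (+-group to xor-group; +-commutativeSemigroup to xor-commutativeSemigroup)
open import Algebra.Properties.Group xor-group using (∙-cancelʳ; x∙y⁻¹≈ε⇒x≈y; x≈y⇒x∙y⁻¹≈ε)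
open import Algebra.Properties.CommutativeSemigroup xor-commutativeSemigroup using (interchange)

First : (ℕ → Set) → ℕ → Set
First P d = P d × (∀ r → r < d → ¬ P r)

first : ∀ {P : ℕ → Set} → (∀ r → Dec (P r)) → ∀ {d} → P d → ∃ λ d′ → d′ ≤ d × First P d′
first P? {zero}  Pd = 0 , z≤n , Pd , λ _ ()
first P? {suc d} Pd with P? 0
... | yes P0 = 0 , z≤n , P0 , λ _ ()
... | no ¬P0 with first (P? ∘ suc) Pd
...   | d′ , d′≤d , Pd′ , below = suc d′ , s≤s d′≤d , Pd′ , λ where
          zero    _          → ¬P0
          (suc r) (s≤s r<d′) → below r r<d′

First-unique : ∀ {P d d′} → First P d → First P d′ → d ≡ d′
First-unique {d = d} {d′} (Pd , below) (Pd′ , below′) with <-cmp d d′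
... | tri< d<d′ _ _ = contradiction Pd (below′ d d<d′)
... | tri≈ _ d≡d′ _ = d≡d′
... | tri> _ _ d′<d = contradiction Pd′ (below d′ d′<d)

FirstOne : (ℕ → Bool) → ℕ → Set
FirstOne g = First (λ r → g r ≡ true)

FirstOne-resp : ∀ {g h d} → g ≗ h → FirstOne g d → FirstOne h d
FirstOne-resp g≗h (gd , below) = trans (sym (g≗h _)) gd , λ r r<d hr → below r r<d (trans (g≗h r) hr)

data EvenOdd : ℕ → Set where
  even : ∀ h → EvenOdd (2 * h)
  odd  : ∀ h → EvenOdd (suc (2 * h))

evenOdd : ∀ m → EvenOdd m
evenOdd zero = even 0
evenOdd (suc m) with evenOdd m
... | even h = odd h
... | odd h  = subst EvenOdd (*-distribˡ-+ 2 1 h) (even (suc h))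

odd≤even⇒< : ∀ {h w} → suc (2 * h) ≤ 2 * w → h < w
odd≤even⇒< le = ≰⇒> λ w≤h → 1+n≰n (≤-trans le (*-monoʳ-≤ 2 w≤h))

odd<even : ∀ {h u} → h < u → suc (2 * h) < 2 * u
odd<even {h} {u} h<u = subst (_≤ 2 * u) (*-distribˡ-+ 2 1 h) (*-monoʳ-≤ 2 h<u)

suc-+-odd : ∀ p h → suc (p + suc (2 * h)) ≡ p + 2 * suc h
suc-+-odd = solve-∀

shift : ∀ {A : Set} → ℕ → (ℕ → A) → ℕ → A
shift p X c = X (p + c)

Periodic : {A : Set} → ℕ → (ℕ → A) → Set
Periodic n X = ∀ i → X (i + n) ≡ X i

module _ {A : Set} {n : ℕ} {X : ℕ → A} (periodic : Periodic n X) where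

  periodic-+* : ∀ k i → X (i + k * n) ≡ X i
  periodic-+* zero    i = cong X (+-identityʳ i)
  periodic-+* (suc k) i = begin
    X (i + (n + k * n)) ≡⟨ cong X (reorder i n (k * n)) ⟩
    X (i + k * n + n)   ≡⟨ periodic (i + k * n) ⟩
    X (i + k * n)       ≡⟨ periodic-+* k i ⟩
    X i                 ∎
    where
    open ≡-Reasoning
    reorder : ∀ i n m → i + (n + m) ≡ i + m + n
    reorder = solve-∀

  periodic-mod : .{{_ : NonZero n}} → ∀ i → X i ≡ X (i % n)
  periodic-mod i = trans (cong X (m≡m%n+[m/n]*n i n)) (periodic-+* (i / n) (i % n))

vanishes-or-one : ∀ {N} .{{_ : NonZero N}} {h : ℕ → Bool} → Periodic N h →
  (∀ i → h i ≡ false) ⊎ ∃ λ i → h i ≡ true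
vanishes-or-one {N} {h} periodic with any? (λ (i : Fin N) → h (toℕ i) Bool.≟ true)
... | yes (i , hi) = inj₂ (toℕ i , hi)
... | no none = inj₁ λ i → ¬-not λ hi →
  none (fromℕ< (m%n<n i N) , trans (cong h (toℕ-fromℕ< _)) (trans (sym (periodic-mod periodic i)) hi))

xorSum : ℕ → (ℕ → Bool) → Bool
xorSum zero    f = false
xorSum (suc m) f = xorSum m f xor f (suc m)

xorSum-cong : ∀ m {f g} → (∀ k → f (suc k) ≡ g (suc k)) → xorSum m f ≡ xorSum m g
xorSum-cong zero    _   = refl
xorSum-cong (suc m) f≡g = cong₂ _xor_ (xorSum-cong m f≡g) (f≡g m)

xorSum-false : ∀ m {f} → (∀ k → f (suc k) ≡ false) → xorSum m f ≡ false
xorSum-false zero    _   = refl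
xorSum-false (suc m) f≡0 = cong₂ _xor_ (xorSum-false m f≡0) (f≡0 m)

xorSum-xor : ∀ m f g → xorSum m (λ k → f k xor g k) ≡ xorSum m f xor xorSum m g
xorSum-xor zero    f g = refl
xorSum-xor (suc m) f g =
  trans (cong (_xor (f (suc m) xor g (suc m))) (xorSum-xor m f g))
        (interchange (xorSum m f) (xorSum m g) (f (suc m)) (g (suc m)))

xorSum-∧ʳ : ∀ m f b → xorSum m (λ k → f k ∧ b) ≡ xorSum m f ∧ b
xorSum-∧ʳ zero    f b = refl
xorSum-∧ʳ (suc m) f b =
  trans (cong (_xor (f (suc m) ∧ b)) (xorSum-∧ʳ m f b)) (sym (∧-distribʳ-xor b (xorSum m f) (f (suc m))))

xor-telescope : ∀ x y z → (x xor y) xor (y xor z) ≡ x xor z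
xor-telescope x y z = begin
  (x xor y) xor (y xor z) ≡⟨ xor-assoc x y (y xor z) ⟩
  x xor (y xor (y xor z)) ≡⟨ cong (x xor_) (sym (xor-assoc y y z)) ⟩
  x xor ((y xor y) xor z) ≡⟨ cong (λ b → x xor (b xor z)) (xor-same y) ⟩
  x xor z                 ∎
  where open ≡-Reasoning

Δ : (ℕ → Bool) → ℕ → Bool
Δ e i = e i xor e (suc i)

iterate-+ : ∀ {A : Set} (f : A → A) x i j → iterate f x (i + j) ≡ iterate f (iterate f x i) j
iterate-+ f x zero    j = refl
iterate-+ f x (suc i) j = iterate-+ f (f x) i j

Δ-iterate-2^ : ∀ t e i → iterate Δ e (2 ^ t) i ≡ e i xor e (i + 2 ^ t)
Δ-iterate-2^ zero    e i = cong (λ j → e i xor e j) (+-comm 1 i)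
Δ-iterate-2^ (suc t) e i = begin
  iterate Δ e (q + (q + 0)) i
    ≡⟨ cong (λ k → iterate Δ e (q + k) i) (+-identityʳ q) ⟩
  iterate Δ e (q + q) i
    ≡⟨ cong (λ f → f i) (iterate-+ Δ e q q) ⟩
  iterate Δ (iterate Δ e q) q i
    ≡⟨ Δ-iterate-2^ t (iterate Δ e q) i ⟩
  iterate Δ e q i xor iterate Δ e q (i + q)
    ≡⟨ cong₂ _xor_ (Δ-iterate-2^ t e i) (Δ-iterate-2^ t e (i + q)) ⟩
  (e i xor e (i + q)) xor (e (i + q) xor e (i + q + q))
    ≡⟨ xor-telescope (e i) (e (i + q)) (e (i + q + q)) ⟩
  e i xor e (i + q + q)
    ≡⟨ cong (λ j → e i xor e j) (double i q) ⟩
  e i xor e (i + (q + (q + 0))) ∎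
  where
  open ≡-Reasoning
  q = 2 ^ t
  double : ∀ i q → i + q + q ≡ i + (q + (q + 0))
  double = solve-∀

Δ-vanishes⇒constant : ∀ {e} → (∀ i → Δ e i ≡ false) → ∀ i k → e (i + k) ≡ e i
Δ-vanishes⇒constant {e} Δe≡0 i zero    = cong e (+-identityʳ i)
Δ-vanishes⇒constant {e} Δe≡0 i (suc k) = begin
  e (i + suc k)   ≡⟨ cong e (+-suc i k) ⟩
  e (suc (i + k)) ≡⟨ sym (x∙y⁻¹≈ε⇒x≈y _ _ (Δe≡0 (i + k))) ⟩
  e (i + k)       ≡⟨ Δ-vanishes⇒constant {e} Δe≡0 i k ⟩
  e i             ∎
  where open ≡-Reasoning

suc-%2 : ∀ c b → c % 2 ≡ (if b then 1 else 0) → suc c % 2 ≡ (if not b then 1 else 0)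
suc-%2 c false c%2 = trans (%-distribˡ-+ 1 c 2) (cong (λ r → suc r % 2) c%2)
suc-%2 c true  c%2 = trans (%-distribˡ-+ 1 c 2) (cong (λ r → suc r % 2) c%2)

countNZ-%2 : ∀ a m → countNZ a m % 2 ≡ (if xorSum m a then 1 else 0)
countNZ-%2 a zero = refl
countNZ-%2 a (suc m) with a (suc m)
... | false = trans (countNZ-%2 a m) (cong (if_then 1 else 0) (sym (xor-identityʳ _)))
... | true  = trans (suc-%2 (countNZ a m) _ (countNZ-%2 a m)) (cong (if_then 1 else 0) (xor-comm true _))

odd-count⇔xorSum-false : ∀ a m → ((1 + countNZ a m) % 2 ≡ 1) ⇔ (xorSum m a ≡ false)
odd-count⇔xorSum-false a m with xorSum m a | suc-%2 (countNZ a m) _ (countNZ-%2 a m)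
... | false | [1+c]%2≡1 = mk⇔ (λ _ → refl) (λ _ → [1+c]%2≡1)
... | true  | [1+c]%2≡0 = mk⇔ (λ [1+c]%2≡1 → contradiction (trans (sym [1+c]%2≡0) [1+c]%2≡1) 0≢1+n) (λ ())

-- Injective maps of F₂ⁿ are surjective

Fin-injective⇒surjective : ∀ {k} {f : Fin k → Fin k} → Injective _≡_ _≡_ f → ∀ y → ∃ λ x → f x ≡ y
Fin-injective⇒surjective {suc k} {f} f-inj y with any? (λ x → f x Fin.≟ y)
... | yes hit = hit
... | no miss = contradiction (injective⇒≤ punched-injective) 1+n≰n
  where
  punched : Fin (suc k) → Fin k
  punched x = punchOut {i = y} (λ y≡fx → miss (x , sym y≡fx))
  punched-injective : Injective _≡_ _≡_ punched
  punched-injective eq = f-inj (punchOut-injective {i = y} _ _ eq)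

funToFin-cong : ∀ {m k} {f g : Fin m → Fin k} → f ≗ g → funToFin f ≡ funToFin g
funToFin-cong {zero}  _   = refl
funToFin-cong {suc m} f≗g = cong₂ combine (f≗g Fin.zero) (funToFin-cong (f≗g ∘ Fin.suc))

module _ {n : ℕ} where
  private
    open Inverse 2↔Bool using (to; from; strictlyInverseˡ; strictlyInverseʳ)

    encode : (Fin n → Bool) → Fin (2 ^ n)
    encode x = funToFin (from ∘ x)

    decode : Fin (2 ^ n) → Fin n → Bool
    decode c = to ∘ finToFun {2} {n} c

    encode-injective : ∀ {x y} → encode x ≡ encode y → x ≗ y
    encode-injective {x} {y} eq i = begin
      x i                        ≡⟨ sym (strictlyInverseˡ (x i)) ⟩
      to (from (x i))            ≡⟨ cong to (sym (finToFun-funToFin (from ∘ x) i)) ⟩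
      to (finToFun (encode x) i) ≡⟨ cong (λ c → to (finToFun c i)) eq ⟩
      to (finToFun (encode y) i) ≡⟨ cong to (finToFun-funToFin (from ∘ y) i) ⟩
      to (from (y i))            ≡⟨ strictlyInverseˡ (y i) ⟩
      y i                        ∎
      where open ≡-Reasoning

    decode-injective : ∀ {c c′} → decode c ≗ decode c′ → c ≡ c′
    decode-injective {c} {c′} eq = begin
      c                              ≡⟨ sym (funToFin-finToFin {n} {2} c) ⟩
      funToFin (finToFun {2} {n} c)  ≡⟨ funToFin-cong {n} {2} from-eq ⟩
      funToFin (finToFun {2} {n} c′) ≡⟨ funToFin-finToFin {n} {2} c′ ⟩
      c′                             ∎
      where
      open ≡-Reasoning
      from-eq : finToFun c ≗ finToFun c′
      from-eq i = trans (sym (strictlyInverseʳ _)) (trans (cong from (eq i)) (strictlyInverseʳ _))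

  injective⇒surjective : ∀ {f : (Fin n → Bool) → Fin n → Bool} →
    Congruent _≗_ _≗_ f → Injective _≗_ _≗_ f → Surjective _≗_ _≗_ f
  injective⇒surjective {f} f-cong f-inj =
    strictlySurjective⇒surjective (λ p q i → trans (p i) (q i)) f-cong surjective
    where
    g-injective : Injective _≡_ _≡_ (encode ∘ f ∘ decode)
    g-injective = decode-injective ∘ f-inj ∘ encode-injective

    surjective : StrictlySurjective _≗_ f
    surjective y with Fin-injective⇒surjective g-injective (encode y)
    ... | c , hit = decode c , encode-injective hit

-- Anchors

record Anchor (X : ℕ → Bool) (s : ℕ) : Set where
  constructor anchor
  field
    one  : X s ≡ true
    gap  : ℕ
    next : FirstOne (shift (suc s) X) (2 * gap)

record NearestAnchor (X : ℕ → Bool) (p d : ℕ) : Set where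
  constructor nearest
  field
    found       : Anchor X (p + d)
    none-before : ∀ r → r < d → ¬ Anchor X (p + r)

open Anchor
open NearestAnchor

Anchored : (ℕ → Bool) → Set
Anchored X = ∀ p → ∃ (NearestAnchor X p)

Anchor-resp : ∀ {X Y s} → X ≗ Y → Anchor X s → Anchor Y s
Anchor-resp X≗Y (anchor Xs u next) = anchor (trans (sym (X≗Y _)) Xs) u (FirstOne-resp (λ _ → X≗Y _) next)

anchor-parities : ∀ {X s} → Anchor X s →
  (∃ λ i → X (2 * i) ≡ true) × (∃ λ j → X (suc (2 * j)) ≡ true)
anchor-parities {X} {s} (anchor Xs u (Xnext , _)) with evenOdd s
... | even h = (h , Xs) , (h + u , subst (λ q → X q ≡ true) (cong suc (sym (*-distribˡ-+ 2 h u))) Xnext)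
... | odd h  = (suc (h + u) , subst (λ q → X q ≡ true) (sym (double-suc h u)) Xnext) , (h , Xs)
  where
  double-suc : ∀ h u → 2 * suc (h + u) ≡ suc (suc (2 * h + 2 * u))
  double-suc = solve-∀

nearest-split : ∀ {X p} r {d} → NearestAnchor X p (r + d) → NearestAnchor X (p + r) d
nearest-split {X} {p} r {d} (nearest anc none) = nearest
  (subst (Anchor X) (sym (+-assoc p r d)) anc)
  (λ i i<d → none (r + i) (+-monoʳ-< r i<d) ∘ subst (Anchor X) (+-assoc p r i))

nearest-even-offset : ∀ {X p} k {t} → NearestAnchor X p (2 * (k + t)) → NearestAnchor X (p + 2 * k) (2 * t)
nearest-even-offset {X} {p} k {t} = nearest-split (2 * k) ∘ subst (NearestAnchor X p) (*-distribˡ-+ 2 k t)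

nearest-odd-offset : ∀ {X p e j} → NearestAnchor X p (2 * e) → j < e →
  ∃ λ t → NearestAnchor X (p + suc (2 * j)) (suc (2 * t))
nearest-odd-offset {X} {p} {j = j} near j<e with m≤n⇒∃[o]m+o≡n j<e
... | t , refl = t , nearest-split (suc (2 * j)) (subst (NearestAnchor X p) (split j t) near)
  where
  split : ∀ j t → 2 * (suc j + t) ≡ suc (2 * j) + suc (2 * t)
  split = solve-∀

odd-gap⇒anchor : ∀ {X} p w → X p ≡ true → X (p + suc (2 * w)) ≡ true →
  ∃ λ r → r ≤ 2 * w × Anchor X (p + r)
odd-gap⇒anchor {X} p w = go p w (<-wellFounded w)
  where
  remaining-gap : ∀ p h w → p + suc (2 * (suc h + w)) ≡ p + 2 * suc h + suc (2 * w)
  remaining-gap = solve-∀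

  go : ∀ p w → Acc _<_ w → X p ≡ true → X (p + suc (2 * w)) ≡ true →
       ∃ λ r → r ≤ 2 * w × Anchor X (p + r)
  go p w (acc smaller) Xp Xq
    with first (λ r → X (suc (p + r)) Bool.≟ true) (subst (λ q → X q ≡ true) (+-suc p (2 * w)) Xq)
  ... | v , v≤2w , next with evenOdd v
  ...   | even u = 0 , z≤n , subst (Anchor X) (sym (+-identityʳ p)) (anchor Xp u next)
  ...   | odd h with m≤n⇒∃[o]m+o≡n (odd≤even⇒< {h} {w} v≤2w)
  ...     | w′ , refl
    with go (p + 2 * suc h) w′ (smaller (m<n+m w′ z<s))
            (subst (λ q → X q ≡ true) (suc-+-odd p h) (proj₁ next))
            (subst (λ q → X q ≡ true) (remaining-gap p h w′) Xq)
  ...       | r , r≤2w′ , anc =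
    2 * suc h + r ,
    subst (2 * suc h + r ≤_) (sym (*-distribˡ-+ 2 (suc h) w′)) (+-monoʳ-≤ (2 * suc h) r≤2w′) ,
    subst (Anchor X) (+-assoc p (2 * suc h) r) anc

zero-before-odd : ∀ {X p w} → NearestAnchor X p (suc (2 * w)) → X p ≡ false
zero-before-odd {X} {p} {w} (nearest anc none) = ¬-not λ Xp →
  let r , r≤2w , anc-r = odd-gap⇒anchor p w Xp (one anc) in none r (s≤s r≤2w) anc-r

odd-before-nearest : ∀ {X p e j} → NearestAnchor X p (2 * e) → j < e → X (p + suc (2 * j)) ≡ false
odd-before-nearest near j<e with nearest-odd-offset near j<e
... | t , near′ = zero-before-odd {w = t} near′

next-anchor-odd : ∀ {X s d} → Anchor X s → NearestAnchor X (suc s) d → ∃ λ w → d ≡ 2 * w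
next-anchor-odd {d = d} _ _ with evenOdd d
next-anchor-odd _ _ | even w = w , refl
next-anchor-odd {X} {s} (anchor _ u (Xnext , zeros)) near | odd h with u ≤? h
... | no u≰h = contradiction (one (found near)) (zeros (suc (2 * h)) (odd<even (≰⇒> u≰h)))
... | yes u≤h with m≤n⇒∃[o]m+o≡n u≤h
...   | t , refl = contradiction Xnext (not-¬ (zero-before-odd {w = t}
          (nearest-split (2 * u) (subst (NearestAnchor X (suc s)) (split u t) near))))
  where
  split : ∀ u t → suc (2 * (u + t)) ≡ 2 * u + suc (2 * t)
  split = solve-∀

module _ {n : ℕ} .{{_ : NonZero n}} {X : ℕ → Bool} (periodic : Periodic n X) where

  one-period-later : ∀ {s} → X s ≡ true → X (suc (s + pred n)) ≡ true
  one-period-later {s} Xs = begin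
    X (suc (s + pred n)) ≡⟨ cong X (sym (+-suc s (pred n))) ⟩
    X (s + suc (pred n)) ≡⟨ cong (λ m → X (s + m)) (suc-pred n) ⟩
    X (s + n)            ≡⟨ periodic s ⟩
    X s                  ≡⟨ Xs ⟩
    true                 ∎
    where open ≡-Reasoning

  anchor? : ∀ s → Dec (Anchor X s)
  anchor? s with X s Bool.≟ true
  ... | no Xs≢true = no (Xs≢true ∘ one)
  ... | yes Xs with first (λ r → X (suc (s + r)) Bool.≟ true) (one-period-later Xs)
  ...   | v , _ , next with evenOdd v
  ...     | even u = yes (anchor Xs u next)
  ...     | odd h  = no λ anc → even≢odd (gap anc) h (First-unique (Anchor.next anc) next)

  anchor-+* : ∀ {s} c → Anchor X s → Anchor X (s + c * n)
  anchor-+* {s} c (anchor Xs u next) = anchor (trans (periodic-+* periodic c s) Xs) u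
    (FirstOne-resp (λ r → sym (same-value r)) next)
    where
    reorder : ∀ s m r → suc (s + m + r) ≡ suc (s + r) + m
    reorder = solve-∀
    same-value : ∀ r → X (suc (s + c * n + r)) ≡ X (suc (s + r))
    same-value r = trans (cong X (reorder s (c * n) r)) (periodic-+* periodic c (suc (s + r)))

  periodic⇒anchored : ∀ {s} → Anchor X s → Anchored X
  periodic⇒anchored {s} anc p with m≤n⇒∃[o]m+o≡n (≤-trans (m≤m*n p n) (m≤n+m (p * n) s))
  ... | d , p+d≡s+pn with first (λ r → anchor? (p + r)) (subst (Anchor X) (sym p+d≡s+pn) (anchor-+* p anc))
  ...   | d′ , _ , anc′ , none = d′ , nearest anc′ none

-- Streams vanishing on a parity class

VanishesOnOdds : (ℕ → Bool) → Set
VanishesOnOdds X = ∀ i → X (suc (2 * i)) ≡ false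

VanishesOnEvens : (ℕ → Bool) → Set
VanishesOnEvens X = ∀ i → X (2 * i) ≡ false

VanishesOnAParity : (ℕ → Bool) → Set
VanishesOnAParity X = VanishesOnOdds X ⊎ VanishesOnEvens X

evens⇒odds-of-suc : ∀ {X} → VanishesOnEvens X → VanishesOnOdds (X ∘ suc)
evens⇒odds-of-suc {X} evens i = subst (λ q → X q ≡ false) (*-distribˡ-+ 2 1 i) (evens (suc i))

module _ {N : ℕ} {X : ℕ → Bool} (periodic : Periodic (2 * N) X) where

  evens-periodic : Periodic N (λ i → X (2 * i))
  evens-periodic i = trans (cong X (*-distribˡ-+ 2 i N)) (periodic (2 * i))

  odds-periodic : Periodic N (λ i → X (suc (2 * i)))
  odds-periodic i = trans (cong (X ∘ suc) (*-distribˡ-+ 2 i N)) (periodic (suc (2 * i)))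

  both-parities⇒anchor : .{{_ : NonZero N}} → ∀ {i j} →
    X (2 * i) ≡ true → X (suc (2 * j)) ≡ true → ∃ (Anchor X)
  both-parities⇒anchor {i} {j} Xi Xj with odd-gap⇒anchor (2 * i) (j + i * pred N) Xi later-odd-one
    where
    later-odd-one : X (2 * i + suc (2 * (j + i * pred N))) ≡ true
    later-odd-one = begin
      X (2 * i + suc (2 * (j + i * pred N)))   ≡⟨ cong X (arrange i j (pred N)) ⟩
      X (suc (2 * j) + i * (2 * suc (pred N))) ≡⟨ cong (λ n → X (suc (2 * j) + i * (2 * n))) (suc-pred N) ⟩
      X (suc (2 * j) + i * (2 * N))            ≡⟨ periodic-+* periodic i (suc (2 * j)) ⟩
      X (suc (2 * j))                          ≡⟨ Xj ⟩
      true                                     ∎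
      where
      open ≡-Reasoning
      arrange : ∀ i j n → 2 * i + suc (2 * (j + i * n)) ≡ suc (2 * j) + i * (2 * suc n)
      arrange = solve-∀
  ... | r , _ , anc = 2 * i + r , anc

classify : ∀ {N X} .{{_ : NonZero N}} → Periodic (2 * N) X → VanishesOnAParity X ⊎ ∃ (Anchor X)
classify periodic with vanishes-or-one (evens-periodic periodic) | vanishes-or-one (odds-periodic periodic)
... | inj₁ evens    | _             = inj₁ (inj₂ evens)
... | inj₂ _        | inj₁ odds     = inj₁ (inj₁ odds)
... | inj₂ (i , Xi) | inj₂ (j , Xj) = inj₂ (both-parities⇒anchor periodic {i} {j} Xi Xj)

alternating : ℕ → Bool
alternating zero    = true
alternating (suc i) = not (alternating i)

alternating-+2* : ∀ i k → alternating (i + 2 * k) ≡ alternating i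
alternating-+2* i zero    = cong alternating (+-identityʳ i)
alternating-+2* i (suc k) = begin
  alternating (i + 2 * suc k)         ≡⟨ cong alternating (two-more i k) ⟩
  not (not (alternating (i + 2 * k))) ≡⟨ not-involutive _ ⟩
  alternating (i + 2 * k)             ≡⟨ alternating-+2* i k ⟩
  alternating i                       ∎
  where
  open ≡-Reasoning
  two-more : ∀ i k → i + 2 * suc k ≡ suc (suc (i + 2 * k))
  two-more = solve-∀

alternating-vanishesOnOdds : VanishesOnOdds alternating
alternating-vanishesOnOdds i = cong not (alternating-+2* 0 i)

alternating-periodic : ∀ N → Periodic (2 * N) alternating
alternating-periodic N i = alternating-+2* i N

-- The expansion γ₀ + Σₖ aₖ γ_{2k} on streams

module Expansion (a : ℕ → Bool) (m : ℕ) where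

  guard : ℕ → (ℕ → Bool) → Bool
  guard zero    g = true
  guard (suc k) g = guard k g ∧ not (g (suc (2 * k)))

  γ-term : ℕ → (ℕ → Bool) → Bool
  γ-term k g = g (2 * k) ∧ guard k g

  γ-sum : (ℕ → Bool) → Bool
  γ-sum g = xorSum m (λ k → a k ∧ γ-term k g)

  F : (ℕ → Bool) → ℕ → Bool
  F X i = X i xor γ-sum (shift i X)

  guard-cong : ∀ k {g h} → g ≗ h → guard k g ≡ guard k h
  guard-cong zero    _   = refl
  guard-cong (suc k) g≗h = cong₂ (λ b c → b ∧ not c) (guard-cong k g≗h) (g≗h _)

  γ-sum-cong : ∀ {g h} → g ≗ h → γ-sum g ≡ γ-sum h
  γ-sum-cong g≗h = xorSum-cong m λ k → cong (a (suc k) ∧_) (cong₂ _∧_ (g≗h _) (guard-cong (suc k) g≗h))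

  F-resp : ∀ {X Y i j} → (∀ c → X (i + c) ≡ Y (j + c)) → F X i ≡ F Y j
  F-resp {X} {Y} {i} {j} eq = cong₂ _xor_ here (γ-sum-cong eq)
    where
    here : X i ≡ Y j
    here = trans (cong X (sym (+-identityʳ i))) (trans (eq 0) (cong Y (+-identityʳ j)))

  F-periodic : ∀ {n X} → Periodic n X → Periodic n (F X)
  F-periodic {n} {X} periodic i =
    F-resp {X} {X} {i + n} {i} λ c → trans (cong X (reorder i n c)) (periodic (i + c))
    where
    reorder : ∀ i n c → i + n + c ≡ i + c + n
    reorder = solve-∀

  guard-true : ∀ k {g} → (∀ j → j < k → g (suc (2 * j)) ≡ false) → guard k g ≡ true
  guard-true zero    _     = refl
  guard-true (suc k) clear =
    cong₂ (λ b c → b ∧ not c) (guard-true k λ j j<k → clear j (m<n⇒m<1+n j<k)) (clear k ≤-refl)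

  guard-false : ∀ {k g} j → j < k → g (suc (2 * j)) ≡ true → guard k g ≡ false
  guard-false {suc k} {g} j j<1+k gj with m<1+n⇒m<n∨m≡n j<1+k
  ... | inj₁ j<k  = cong (_∧ not (g (suc (2 * k)))) (guard-false j j<k gj)
  ... | inj₂ refl = trans (cong (λ b → guard k g ∧ not b) gj) (∧-zeroʳ _)

  γ-term-clear : ∀ k {g} → (∀ j → j < k → g (suc (2 * j)) ≡ false) → γ-term k g ≡ g (2 * k)
  γ-term-clear k clear = trans (cong (_ ∧_) (guard-true k clear)) (∧-identityʳ _)

  γ-term-blocked : ∀ {k g} j → j < k → g (suc (2 * j)) ≡ true → γ-term k g ≡ false
  γ-term-blocked {k} {g} j j<k gj = trans (cong (g (2 * k) ∧_) (guard-false j j<k gj)) (∧-zeroʳ _)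

  γ-sum-vanishes : ∀ {g} → (∀ k → γ-term (suc k) g ≡ false) → γ-sum g ≡ false
  γ-sum-vanishes vanish = xorSum-false m λ k → trans (cong (a (suc k) ∧_) (vanish k)) (∧-zeroʳ _)

  F-vanishes : ∀ {X q} → (∀ k → X (q + 2 * k) ≡ false) → F X q ≡ false
  F-vanishes {X} {q} zeros = cong₂ _xor_ (trans (cong X (sym (+-identityʳ q))) (zeros 0))
    (γ-sum-vanishes λ k → cong (_∧ guard (suc k) (shift q X)) (zeros (suc k)))

  γ-sum-before-odd : ∀ {X p w} → NearestAnchor X (suc p) (2 * w) → γ-sum (shift p X) ≡ false
  γ-sum-before-odd {X} {p} {w} near = γ-sum-vanishes term-vanishes
    where
    term-vanishes : ∀ k → γ-term (suc k) (shift p X) ≡ false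
    term-vanishes k with suc k ≤? w
    ... | yes k<w = cong (_∧ guard (suc k) (shift p X))
                      (subst (λ q → X q ≡ false) (suc-+-odd p k) (odd-before-nearest {e = w} near k<w))
    ... | no  k≮w = γ-term-blocked {suc k} {shift p X} w (≰⇒> k≮w)
                      (subst (λ q → X q ≡ true) (sym (+-suc p (2 * w))) (one (found near)))

  F-before-odd : ∀ {X p w} → NearestAnchor X p (suc (2 * w)) → F X p ≡ false
  F-before-odd {X} {p} {w} near = cong₂ _xor_ (zero-before-odd {w = w} near)
    (γ-sum-before-odd {w = w} (subst (λ q → NearestAnchor X q (2 * w)) (+-comm p 1) (nearest-split 1 near)))

  F-odd-before-nearest : ∀ {X p e j} → NearestAnchor X p (2 * e) → j < e → F X (p + suc (2 * j)) ≡ false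
  F-odd-before-nearest near j<e with nearest-odd-offset near j<e
  ... | t , near′ = F-before-odd {w = t} near′

  F-at-anchor : ∀ {X s} → Anchored X → Anchor X s → F X s ≡ true
  F-at-anchor {s = s} anchored anc with anchored (suc s)
  ... | d , near with next-anchor-odd anc near
  ... | w , refl = cong₂ _xor_ (one anc) (γ-sum-before-odd {w = w} near)

  anchor⇒F-anchor : ∀ {X s} → Anchored X → Anchor X s → Anchor (F X) s
  anchor⇒F-anchor {X} {s} anchored anc with anchored (suc s)
  ... | d , near with next-anchor-odd anc near
  ... | w , refl with first (λ r → F X (suc (s + r)) Bool.≟ true) (F-at-anchor anchored (found near))
  ... | v , v≤2w , next with evenOdd v
  ...   | even u = anchor (F-at-anchor anchored anc) u next
  ...   | odd h  = contradiction (proj₁ next) (not-¬ (F-odd-before-nearest near (odd≤even⇒< {h} {w} v≤2w)))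

  F-anchor⇒anchor : ∀ {X s} → Anchored X → Anchor (F X) s → Anchor X s
  F-anchor⇒anchor {X} {s} anchored (anchor FXs u (FXnext , zeros)) with anchored s
  ... | d , near with evenOdd d
  ... | odd w       = contradiction FXs (not-¬ (F-before-odd {w = w} near))
  ... | even zero   = subst (Anchor X) (+-identityʳ s) (found near)
  ... | even (suc e) with u ≤? e
  ...   | yes u≤e = contradiction (subst (λ q → F X q ≡ true) (sym (+-suc s (2 * u))) FXnext)
                      (not-¬ (F-odd-before-nearest near (s≤s u≤e)))
  ...   | no  u≰e = contradiction
                      (subst (λ q → F X q ≡ true) (sym (suc-+-odd s e)) (F-at-anchor anchored (found near)))
                      (zeros (suc (2 * e)) (odd<even (≰⇒> u≰e)))

  γ-term-before-nearest : ∀ {X p e k} → NearestAnchor X p (2 * e) → k ≤ e →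
    γ-term k (shift p X) ≡ X (p + 2 * k)
  γ-term-before-nearest near k≤e = γ-term-clear _ λ j j<k → odd-before-nearest near (<-≤-trans j<k k≤e)

  γ-term-beyond-anchor : ∀ {X p e k} → Anchor X (p + 2 * e) → e < k → γ-term k (shift p X) ≡ false
  γ-term-beyond-anchor {X} {p} {e} {k} (anchor _ u (Xnext , zeros)) e<k with k ≤? e + u
  ... | no  k≰e+u = γ-term-blocked (e + u) (≰⇒> k≰e+u) (subst (λ q → X q ≡ true) (next-one p e u) Xnext)
    where
    next-one : ∀ p e u → suc (p + 2 * e + 2 * u) ≡ p + suc (2 * (e + u))
    next-one = solve-∀
  ... | yes k≤e+u with m≤n⇒∃[o]m+o≡n e<k
  ...   | t , refl = cong (_∧ guard k (shift p X)) (subst (λ q → X q ≡ false) (between p e t)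
                       (¬-not (zeros (suc (2 * t)) (odd<even (+-cancelˡ-< e t u k≤e+u)))))
    where
    between : ∀ p e t → suc (p + 2 * e + suc (2 * t)) ≡ p + 2 * (suc e + t)
    between = solve-∀

  reconstruct : ∀ {X Y} → (∀ {s} → Anchor X s → Anchor Y s) → (∀ {s} → Anchor Y s → Anchor X s) →
    F X ≗ F Y → ∀ {p d} → NearestAnchor X p d → X p ≡ Y p
  reconstruct {X} {Y} X⇒Y Y⇒X FX≗FY {d = d} = go d (<-wellFounded d)
    where
    transfer : ∀ {p d} → NearestAnchor X p d → NearestAnchor Y p d
    transfer (nearest anc none) = nearest (X⇒Y anc) λ r r<d → none r r<d ∘ Y⇒X

    go : ∀ {p} d → Acc _<_ d → NearestAnchor X p d → X p ≡ Y p
    go d _ near with evenOdd d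
    go {p} _ _ near | odd w =
      trans (zero-before-odd {w = w} near) (sym (zero-before-odd {w = w} (transfer near)))
    go {p} _ _ near | even zero =
      trans (subst (λ q → X q ≡ true) (+-identityʳ p) (one (found near)))
            (sym (subst (λ q → Y q ≡ true) (+-identityʳ p) (one (found (transfer near)))))
    go {p} _ (acc smaller) near | even (suc e) =
      ∙-cancelʳ (γ-sum (shift p X)) (X p) (Y p) (trans (FX≗FY p) (cong (Y p xor_) (sym same-γ-sum)))
      where
      same-term : ∀ k → γ-term (suc k) (shift p X) ≡ γ-term (suc k) (shift p Y)
      same-term k with suc k ≤? suc e
      ... | no  k≮e+1 = trans (γ-term-beyond-anchor (found near) (≰⇒> k≮e+1))
                               (sym (γ-term-beyond-anchor (found (transfer near)) (≰⇒> k≮e+1)))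
      ... | yes k<e+1 with m≤n⇒∃[o]m+o≡n k<e+1
      ...   | t , k+1+t≡e+1 = begin
        γ-term (suc k) (shift p X) ≡⟨ γ-term-before-nearest {e = suc e} near k<e+1 ⟩
        X (p + 2 * suc k)          ≡⟨ go (2 * t) (smaller t<e) (nearest-even-offset (suc k) near′) ⟩
        Y (p + 2 * suc k)          ≡⟨ sym (γ-term-before-nearest {e = suc e} (transfer near) k<e+1) ⟩
        γ-term (suc k) (shift p Y) ∎
        where
        open ≡-Reasoning
        near′ : NearestAnchor X p (2 * (suc k + t))
        near′ = subst (λ e → NearestAnchor X p (2 * e)) (sym k+1+t≡e+1) near
        t<e : 2 * t < 2 * suc e
        t<e = subst (λ e → 2 * t < 2 * e) k+1+t≡e+1 (*-monoʳ-< 2 (m<n+m t z<s))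

      same-γ-sum : γ-sum (shift p X) ≡ γ-sum (shift p Y)
      same-γ-sum = xorSum-cong m λ k → cong (a (suc k) ∧_) (same-term k)

  anchored-injective : ∀ {X Y} → Anchored X → Anchored Y → F X ≗ F Y → X ≗ Y
  anchored-injective {X} {Y} anchoredX anchoredY FX≗FY p = reconstruct X⇒Y Y⇒X FX≗FY (proj₂ (anchoredX p))
    where
    X⇒Y : ∀ {s} → Anchor X s → Anchor Y s
    X⇒Y = F-anchor⇒anchor anchoredY ∘ Anchor-resp FX≗FY ∘ anchor⇒F-anchor anchoredX
    Y⇒X : ∀ {s} → Anchor Y s → Anchor X s
    Y⇒X = F-anchor⇒anchor anchoredX ∘ Anchor-resp (sym ∘ FX≗FY) ∘ anchor⇒F-anchor anchoredY

  F-vanishesOnOdds : ∀ {X} → VanishesOnOdds X → VanishesOnOdds (F X)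
  F-vanishesOnOdds {X} odds i =
    F-vanishes {X} λ k → subst (λ q → X q ≡ false) (cong suc (*-distribˡ-+ 2 i k)) (odds (i + k))

  F-vanishesOnEvens : ∀ {X} → VanishesOnEvens X → VanishesOnEvens (F X)
  F-vanishesOnEvens {X} evens i =
    F-vanishes {X} λ k → subst (λ q → X q ≡ false) (*-distribˡ-+ 2 i k) (evens (i + k))

  anchored⇒¬vanishing : ∀ {n X Y s} .{{_ : NonZero n}} → Periodic n X → Anchor X s → F X ≗ F Y →
    ¬ VanishesOnAParity Y
  anchored⇒¬vanishing {X = X} {Y} pX anc FX≗FY vanishing
    with anchor-parities (anchor⇒F-anchor (periodic⇒anchored pX anc) anc) | vanishing
  ... | _ , (j , FXj) | inj₁ odds  =
    contradiction (trans (sym (FX≗FY _)) FXj) (not-¬ (F-vanishesOnOdds {Y} odds j))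
  ... | (i , FXi) , _ | inj₂ evens =
    contradiction (trans (sym (FX≗FY _)) FXi) (not-¬ (F-vanishesOnEvens {Y} evens i))

  L : (ℕ → Bool) → ℕ → Bool
  L e i = e i xor xorSum m (λ k → a k ∧ e (i + k))

  F-at-even : ∀ {X} → VanishesOnOdds X → ∀ i → F X (2 * i) ≡ L (λ j → X (2 * j)) i
  F-at-even {X} odds i = cong (X (2 * i) xor_) (xorSum-cong m λ k → cong (a (suc k) ∧_) (begin
    γ-term (suc k) (shift (2 * i) X) ≡⟨ γ-term-clear (suc k) {shift (2 * i) X} (λ j _ → odd-zero j) ⟩
    X (2 * i + 2 * suc k)            ≡⟨ cong X (sym (*-distribˡ-+ 2 i (suc k))) ⟩
    X (2 * (i + suc k))              ∎))
    where
    open ≡-Reasoning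
    odd-position : ∀ i j → suc (2 * (i + j)) ≡ 2 * i + suc (2 * j)
    odd-position = solve-∀
    odd-zero : ∀ j → X (2 * i + suc (2 * j)) ≡ false
    odd-zero j = subst (λ q → X q ≡ false) (odd-position i j) (odds (i + j))

  L-xor : ∀ e e′ i → L (λ j → e j xor e′ j) i ≡ L e i xor L e′ i
  L-xor e e′ i = begin
    (e i xor e′ i) xor xorSum m (λ k → a k ∧ (e (i + k) xor e′ (i + k)))
      ≡⟨ cong ((e i xor e′ i) xor_) (xorSum-cong m λ k → ∧-distribˡ-xor (a (suc k)) _ _) ⟩
    (e i xor e′ i) xor xorSum m (λ k → (a k ∧ e (i + k)) xor (a k ∧ e′ (i + k)))
      ≡⟨ cong ((e i xor e′ i) xor_) (xorSum-xor m _ _) ⟩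
    (e i xor e′ i) xor (xorSum m (λ k → a k ∧ e (i + k)) xor xorSum m (λ k → a k ∧ e′ (i + k)))
      ≡⟨ interchange (e i) (e′ i) _ _ ⟩
    L e i xor L e′ i ∎
    where open ≡-Reasoning

  L-Δ : ∀ e i → L (Δ e) i ≡ Δ (L e) i
  L-Δ e = L-xor e (e ∘ suc)

  L-constant : ∀ {e i} → (∀ k → e (i + k) ≡ e i) → L e i ≡ e i xor (xorSum m a ∧ e i)
  L-constant {e} {i} constant = cong (e i xor_)
    (trans (xorSum-cong m λ k → cong (a (suc k) ∧_) (constant (suc k))) (xorSum-∧ʳ m a (e i)))

  F-alternating : xorSum m a ≡ true → ∀ i → F alternating i ≡ false
  F-alternating odd-weight i with evenOdd i
  ... | odd h  = F-vanishesOnOdds {alternating} alternating-vanishesOnOdds h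
  ... | even h = begin
    F alternating (2 * h)
      ≡⟨ F-at-even {alternating} alternating-vanishesOnOdds h ⟩
    L (λ j → alternating (2 * j)) h
      ≡⟨ L-constant {λ j → alternating (2 * j)} {h} (λ k → trans (evens (h + k)) (sym (evens h))) ⟩
    alternating (2 * h) xor (xorSum m a ∧ alternating (2 * h))
      ≡⟨ cong₂ (λ b c → b xor (c ∧ b)) (evens h) odd-weight ⟩
    false ∎
    where
    open ≡-Reasoning
    evens : ∀ j → alternating (2 * j) ≡ true
    evens = alternating-+2* 0

  module _ (even-weight : xorSum m a ≡ false) where

    -- L commutes with Δ and fixes every Δ-constant stream, so induction on the number of Δ's applies.
    L-kernel-iterate : ∀ j {e} → (∀ i → L e i ≡ false) → (∀ i → iterate Δ e j i ≡ false) → ∀ i → e i ≡ false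
    L-kernel-iterate zero    _        Δʲe≡0   = Δʲe≡0
    L-kernel-iterate (suc j) {e} Le≡0 Δʲ⁺¹e≡0 i = begin
      e i                        ≡⟨ sym (xor-identityʳ (e i)) ⟩
      e i xor (false ∧ e i)      ≡⟨ cong (λ b → e i xor (b ∧ e i)) (sym even-weight) ⟩
      e i xor (xorSum m a ∧ e i) ≡⟨ sym (L-constant {e} (Δ-vanishes⇒constant {e} Δe≡0 i)) ⟩
      L e i                      ≡⟨ Le≡0 i ⟩
      false                      ∎
      where
      open ≡-Reasoning
      Δe≡0 : ∀ i → Δ e i ≡ false
      Δe≡0 = L-kernel-iterate j (λ i → trans (L-Δ e i) (cong₂ _xor_ (Le≡0 i) (Le≡0 (suc i)))) Δʲ⁺¹e≡0

    L-kernel : ∀ t {e} → Periodic (2 ^ t) e → (∀ i → L e i ≡ false) → ∀ i → e i ≡ false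
    L-kernel t {e} periodic Le≡0 = L-kernel-iterate (2 ^ t) Le≡0 λ i →
      trans (Δ-iterate-2^ t e i) (trans (cong (e i xor_) (periodic i)) (xor-same (e i)))

    L-injective : ∀ t {e e′} → Periodic (2 ^ t) e → Periodic (2 ^ t) e′ → (∀ i → L e i ≡ L e′ i) → e ≗ e′
    L-injective t {e} {e′} pe pe′ Le≡Le′ i = x∙y⁻¹≈ε⇒x≈y _ _ (L-kernel t
      (λ i → cong₂ _xor_ (pe i) (pe′ i)) (λ i → trans (L-xor e e′ i) (x≈y⇒x∙y⁻¹≈ε (Le≡Le′ i))) i)

    module _ (t : ℕ) where
      private
        n = 2 * 2 ^ t
        instance
          2^t≢0 : NonZero (2 ^ t)
          2^t≢0 = m^n≢0 2 t
          n≢0 : NonZero n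
          n≢0 = m^n≢0 2 (suc t)

      vanishesOnOdds-injective : ∀ {X Y} → Periodic n X → Periodic n Y →
        VanishesOnOdds X → VanishesOnOdds Y → F X ≗ F Y → X ≗ Y
      vanishesOnOdds-injective {X} {Y} pX pY oddsX oddsY FX≗FY i with evenOdd i
      ... | odd h  = trans (oddsX h) (sym (oddsY h))
      ... | even h = L-injective t (evens-periodic pX) (evens-periodic pY)
        (λ j → trans (sym (F-at-even {X} oddsX j)) (trans (FX≗FY (2 * j)) (F-at-even {Y} oddsY j))) h

      vanishesOnEvens-injective : ∀ {X Y} → Periodic n X → Periodic n Y →
        VanishesOnEvens X → VanishesOnEvens Y → F X ≗ F Y → X ≗ Y
      vanishesOnEvens-injective pX pY evensX evensY FX≗FY zero = trans (evensX 0) (sym (evensY 0))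
      vanishesOnEvens-injective {X} {Y} pX pY evensX evensY FX≗FY (suc i) =
        vanishesOnOdds-injective {X ∘ suc} {Y ∘ suc} (pX ∘ suc) (pY ∘ suc)
          (evens⇒odds-of-suc {X} evensX) (evens⇒odds-of-suc {Y} evensY) (FX≗FY ∘ suc) i

      vanishesOnOdds-kernel : ∀ {X} → Periodic n X → VanishesOnOdds X → VanishesOnEvens (F X) →
        ∀ i → X i ≡ false
      vanishesOnOdds-kernel {X} pX oddsX FX-evens i with evenOdd i
      ... | odd h  = oddsX h
      ... | even h = L-kernel t (evens-periodic pX) (λ j → trans (sym (F-at-even {X} oddsX j)) (FX-evens j)) h

      odds-vs-evens : ∀ {X Y} → Periodic n X → Periodic n Y →
        VanishesOnOdds X → VanishesOnEvens Y → F X ≗ F Y → X ≗ Y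
      odds-vs-evens {X} {Y} pX pY oddsX evensY FX≗FY i = trans (X≗0 i) (sym (Y≗0 i))
        where
        X≗0 : ∀ i → X i ≡ false
        X≗0 = vanishesOnOdds-kernel {X} pX oddsX λ j → trans (FX≗FY (2 * j)) (F-vanishesOnEvens {Y} evensY j)
        Y≗0 : ∀ i → Y i ≡ false
        Y≗0 zero    = evensY 0
        Y≗0 (suc i) = vanishesOnOdds-kernel {Y ∘ suc} (pY ∘ suc) (evens⇒odds-of-suc {Y} evensY)
          (λ j → trans (sym (FX≗FY (suc (2 * j)))) (F-vanishesOnOdds {X} oddsX j)) i

      vanishing-injective : ∀ {X Y} → Periodic n X → Periodic n Y →
        VanishesOnAParity X → VanishesOnAParity Y → F X ≗ F Y → X ≗ Y
      vanishing-injective pX pY (inj₁ oddsX)  (inj₁ oddsY)  = vanishesOnOdds-injective pX pY oddsX oddsY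
      vanishing-injective pX pY (inj₂ evensX) (inj₂ evensY) = vanishesOnEvens-injective pX pY evensX evensY
      vanishing-injective pX pY (inj₁ oddsX)  (inj₂ evensY) = odds-vs-evens pX pY oddsX evensY
      vanishing-injective pX pY (inj₂ evensX) (inj₁ oddsY)  =
        λ FX≗FY → sym ∘ odds-vs-evens pY pX oddsY evensX (sym ∘ FX≗FY)

      F-injective : ∀ {X Y} → Periodic n X → Periodic n Y → F X ≗ F Y → X ≗ Y
      F-injective {X} {Y} pX pY FX≗FY with classify pX | classify pY
      ... | inj₂ (_ , ancX) | inj₂ (_ , ancY) =
        anchored-injective (periodic⇒anchored pX ancX) (periodic⇒anchored pY ancY) FX≗FY
      ... | inj₂ (_ , ancX) | inj₁ vanishingY =
        ⊥-elim (anchored⇒¬vanishing {Y = Y} pX ancX FX≗FY vanishingY)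
      ... | inj₁ vanishingX | inj₂ (_ , ancY) =
        ⊥-elim (anchored⇒¬vanishing {Y = X} pY ancY (sym ∘ FX≗FY) vanishingX)
      ... | inj₁ vanishingX | inj₁ vanishingY = vanishing-injective pX pY vanishingX vanishingY FX≗FY

-- Back to F₂ⁿ

module OnVectors (n : ℕ) .{{_ : NonZero n}} (a : ℕ → Bool) where
  open Expansion a (n ∸ 1)

  stream : (Fin n → Bool) → ℕ → Bool
  stream x i = x (fromℕ< (m%n<n i n))

  stream-periodic : ∀ x → Periodic n (stream x)
  stream-periodic x i = cong x (fromℕ<-cong _ _ ([m+n]%n≡m%n i n) _ _)

  stream-toℕ : ∀ x i → stream x (toℕ i) ≡ x i
  stream-toℕ x i = cong x (toℕ-injective (trans (toℕ-fromℕ< _) (m<n⇒m%n≡m (toℕ<n i))))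

  prodOdd-guard : ∀ k x i → prodOdd n k x i ≡ guard k (shift (toℕ i) (stream x))
  prodOdd-guard zero    x i = refl
  prodOdd-guard (suc k) x i =
    cong₂ (λ b c → b ∧ not c) (prodOdd-guard k x i) (cong (λ j → stream x (toℕ i + j)) (+-comm (2 * k) 1))

  sumγ-xorSum : ∀ k x i → sumγ n a k x i ≡ xorSum k (λ j → a j ∧ γ-term j (shift (toℕ i) (stream x)))
  sumγ-xorSum zero    x i = refl
  sumγ-xorSum (suc k) x i with a (suc k)
  ... | false = cong (_xor false) (sumγ-xorSum k x i)
  ... | true  = cong₂ _xor_ (sumγ-xorSum k x i)
                  (cong (stream x (toℕ i + 2 * suc k) ∧_) (prodOdd-guard (suc k) x i))

  fExp-stream : ∀ x i → fExp n a x i ≡ F (stream x) (toℕ i)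
  fExp-stream x i = cong₂ _xor_ (sym (stream-toℕ x i)) (sumγ-xorSum (n ∸ 1) x i)

  F-stream : ∀ x j → F (stream x) j ≡ fExp n a x (fromℕ< (m%n<n j n))
  F-stream x j = begin
    F (stream x) j                    ≡⟨ periodic-mod (F-periodic {n} {stream x} (stream-periodic x)) j ⟩
    F (stream x) (j % n)              ≡⟨ cong (F (stream x)) (sym (toℕ-fromℕ< (m%n<n j n))) ⟩
    F (stream x) (toℕ (fromℕ< _))     ≡⟨ sym (fExp-stream x _) ⟩
    fExp n a x (fromℕ< (m%n<n j n))   ∎
    where open ≡-Reasoning

  fExp-congruent : Congruent _≗_ _≗_ (fExp n a)
  fExp-congruent {x} {y} x≗y i =
    trans (fExp-stream x i) (trans (F-resp {stream x} {stream y} (λ _ → x≗y _)) (sym (fExp-stream y i)))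

  fExp-injective : (∀ {X Y} → Periodic n X → Periodic n Y → F X ≗ F Y → X ≗ Y) →
    Injective _≗_ _≗_ (fExp n a)
  fExp-injective F-injective {x} {y} fx≗fy i = begin
    x i              ≡⟨ sym (stream-toℕ x i) ⟩
    stream x (toℕ i) ≡⟨ F-injective (stream-periodic x) (stream-periodic y) F-stream-≗ (toℕ i) ⟩
    stream y (toℕ i) ≡⟨ stream-toℕ y i ⟩
    y i              ∎
    where
    open ≡-Reasoning
    F-stream-≗ : F (stream x) ≗ F (stream y)
    F-stream-≗ j = trans (F-stream x j) (trans (fx≗fy _) (sym (F-stream y j)))

  fExp-not-injective : Periodic n alternating → xorSum (n ∸ 1) a ≡ true → ¬ Injective _≗_ _≗_ (fExp n a)
  fExp-not-injective alternating-periodic odd-weight fExp-inj =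
    contradiction (trans (sym (stream-alternating 0)) (fExp-inj {x₁} {x₀} collision (fromℕ< (m%n<n 0 n))))
                  λ ()
    where
    x₁ x₀ : Fin n → Bool
    x₁ i = alternating (toℕ i)
    x₀ _ = false

    stream-alternating : stream x₁ ≗ alternating
    stream-alternating j =
      trans (cong alternating (toℕ-fromℕ< (m%n<n j n))) (sym (periodic-mod alternating-periodic j))

    collision : fExp n a x₁ ≗ fExp n a x₀
    collision i = begin
      fExp n a x₁ i         ≡⟨ fExp-stream x₁ i ⟩
      F (stream x₁) (toℕ i) ≡⟨ F-resp {stream x₁} {alternating} {toℕ i} {toℕ i} (λ _ → stream-alternating _) ⟩
      F alternating (toℕ i) ≡⟨ F-alternating odd-weight (toℕ i) ⟩
      false                 ≡⟨ sym (F-vanishes {stream x₀} {toℕ i} λ _ → refl) ⟩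
      F (stream x₀) (toℕ i) ≡⟨ sym (fExp-stream x₀ i) ⟩
      fExp n a x₀ i         ∎
      where open ≡-Reasoning

  bijective⇔even-weight : Periodic n alternating →
    (xorSum (n ∸ 1) a ≡ false → ∀ {X Y} → Periodic n X → Periodic n Y → F X ≗ F Y → X ≗ Y) →
    Bijective _≗_ _≗_ (fExp n a) ⇔ (xorSum (n ∸ 1) a ≡ false)
  bijective⇔even-weight alternating-periodic F-injective = mk⇔ even-weight bijective
    where
    even-weight : Bijective _≗_ _≗_ (fExp n a) → xorSum (n ∸ 1) a ≡ false
    even-weight (injective , _) =
      ¬-not λ odd-weight → fExp-not-injective alternating-periodic odd-weight injective

    bijective : xorSum (n ∸ 1) a ≡ false → Bijective _≗_ _≗_ (fExp n a)
    bijective weight≡0 = injective , injective⇒surjective fExp-congruent injective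
      where
      injective : Injective _≗_ _≗_ (fExp n a)
      injective = fExp-injective (F-injective weight≡0)

corollary10 : (s : ℕ) → 1 ≤ s → (a : ℕ → Bool) →
    Bijective _≗_ _≗_ (fExp (2 ^ s) {{m^n≢0 2 s}} a)
      ⇔ ((1 + countNZ a (2 ^ s ∸ 1)) % 2 ≡ 1)
corollary10 (suc t) _ a = ⇔-trans
  (bijective⇔even-weight (alternating-periodic (2 ^ t)) (λ even-weight → F-injective even-weight t))
  (⇔-sym (odd-count⇔xorSum-false a (2 ^ suc t ∸ 1)))
  where
  open OnVectors (2 ^ suc t) {{m^n≢0 2 (suc t)}} a
  open Expansion a (2 ^ suc t ∸ 1) using (F-injective)
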